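{- Let $p$ be a prime, $\alpha\geqslant1$, and $X\subseteq\mathbb{Z}_{p^\alpha}$ satisfy: $0\notin X$, $X\neq-X$, and there is a positive integer $m$ with $(\mathcal{F}\Delta_{U_X})(z)\in\{0,-m\}$ for all $0\neq z$, where $U_X=X\uplus(-X)$. Let $\mathcal{I}_1$ (resp. $\mathcal{I}_2$) be the set of $r\in\{0,\dots,\alpha\}$ such that every element of $O_r$ has multiplicity $2$ (resp. $1$) in $U_X$. Let $\Gamma=\{z\in\mathbb{Z}_{p^\alpha}:(\mathcal{F}\Delta_{U_X})(z)=-m\}$ and $\beta=\min\{\nu_p(z):z\in\Gamma\}$. Then $\mathcal{I}_1$ and $\mathcal{I}_2$ form a partition of $\{\beta+1,\beta+2,\dots,\alpha\}$, and $$U_X=\Big(\bigcup_{r\in\mathcal{I}_1}O_r\Big)\uplus\big(\mathbb{Z}_{p^\alpha}\setminus p^{\alpha-\beta}\mathbb{Z}_{p^\alpha}\big).$$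
   Context: $(\mathcal{F}\Delta_A)(z)=\sum_{i}\Delta_A(i)\zeta^{iz}$ for a multiset $A$ of $\mathbb{Z}_{p^\alpha}$ with multiplicity function $\Delta_A$, $\zeta$ a primitive $p^\alpha$-th root of unity. $\uplus$ is multiset union. $O_i$ ($0\leqslant i\leqslant\alpha$) is the set of elements of additive order $p^i$ in $\mathbb{Z}_{p^\alpha}$; every element of $U_X$'s support lies in such orbits and $U_X$ has constant multiplicity ($0$, $1$ or $2$) on each $O_r$. For $z\in\mathbb{Z}_{p^\alpha}$, $\nu_p(z)$ is the largest $j\leqslant\alpha$ with $p^j\mid z$ (so $\nu_p(0)=\alpha$). $p^{j}\mathbb{Z}_{p^\alpha}$ is the subgroup of multiples of $p^j$. -}

module Defs where

open import Data.Nat using (ℕ; zero; suc; _∸_; _^_; _≤_; _<_)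
import Data.Nat as ℕ
open import Data.Nat.DivMod using (_mod_)
import Data.Integer
open import Data.Integer using (ℤ; +_; _-_) renaming (_+_ to _+ℤ_; _*_ to _*ℤ_)
open import Data.Fin using (Fin; zero; suc; toℕ; _≟_)
open import Data.Bool using (Bool; true; false; if_then_else_)
open import Data.Product using (Σ; ∃; _×_; _,_)
open import Relation.Nullary using (¬_; does)
open import Relation.Binary.PropositionalEquality using (_≡_)

-- The cyclic group ℤ_n, represented by Fin n (residues 0 … n-1).

-- reduction of a natural number modulo n, as an element of ℤ_n;
-- it is only ever used when n is inhabited (hence n = suc _).
-- ofℕ a (given some element of ℤ_n, to know n ≠ 0)
ofℕ : ∀ {n} → Fin n → ℕ → Fin n
ofℕ {suc m} _ a = a mod (suc m)

smul : ∀ {n} → ℕ → Fin n → Fin n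
smul k i = ofℕ i (k ℕ.* toℕ i)

mul : ∀ {n} → Fin n → Fin n → Fin n
mul i z = ofℕ i (toℕ i ℕ.* toℕ z)

neg : ∀ {n} → Fin n → Fin n
neg {n} i = ofℕ i (n ∸ toℕ i)

sub : ∀ {n} → Fin n → Fin n → Fin n
sub {n} k i = ofℕ k (toℕ k ℕ.+ (n ∸ toℕ i))

IsZero : ∀ {n} → Fin n → Set
IsZero i = toℕ i ≡ 0

∑ : ∀ {n} → (Fin n → ℤ) → ℤ
∑ {zero}  f = + 0
∑ {suc n} f = f zero +ℤ ∑ (λ i → f (suc i))

-- The group ring ℤ[ℤ_n] = ℤ[x]/(x^n - 1): coefficient functions.

GR : ℕ → Set
GR n = Fin n → ℤ

mono : ∀ {n} → Fin n → GR n
mono a k = if does (a ≟ k) then + 1 else + 0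

monoℕ : ∀ {n} → ℕ → GR n
monoℕ a k = mono (ofℕ k a) k

const : ∀ {n} → ℤ → GR n
const c k = c *ℤ monoℕ 0 k

conv : ∀ {n} → GR n → GR n → GR n
conv f g k = ∑ (λ i → f i *ℤ g (sub k i))

-- The cyclotomic ring ℤ[ζ] for ζ a primitive p^α-th root of unity,
-- realised as ℤ[x]/(x^(p^α) - 1, Φ_{p^α}(x)) ≅ ℤ[x]/(Φ_{p^α}) ≅ ℤ[ζ] ⊂ ℂ.

cyclo : (p α : ℕ) → GR (p ^ α)
cyclo p α k = ∑ {p} (λ j → monoℕ (toℕ j ℕ.* p ^ (α ∸ 1)) k)

-- equality of the images in ℤ[ζ]: f - g is a multiple of Φ_{p^α}
Eqζ : (p α : ℕ) → GR (p ^ α) → GR (p ^ α) → Set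
Eqζ p α f g = ∃ λ (h : GR (p ^ α)) → ∀ k → f k - g k ≡ conv (cyclo p α) h k

𝓕 : ∀ {n} → (Fin n → ℕ) → Fin n → GR n
𝓕 Δ z k = ∑ (λ i → (+ Δ i) *ℤ mono (mul i z) k)

-- Subsets X ⊆ ℤ_n as characteristic functions, and U_X = X ⊎ (-X)

ind : Bool → ℕ
ind true  = 1
ind false = 0

-- multiplicity function Δ_{U_X}; note i ∈ -X iff -i ∈ X
ΔU : ∀ {n} → (Fin n → Bool) → Fin n → ℕ
ΔU X i = ind (X i) ℕ.+ ind (X (neg i))

HasOrder : ∀ {n} → Fin n → ℕ → Set
HasOrder i d = IsZero (smul d i) × (∀ k → 0 < k → k < d → ¬ IsZero (smul k i))

InO : (p r : ℕ) → ∀ {n} → Fin n → Set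
InO p r i = HasOrder i (p ^ r)

InMult : (p j : ℕ) → ∀ {n} → Fin n → Set
InMult p j {n} i = ∃ λ (y : Fin n) → smul (p ^ j) y ≡ i

IsVal : (p α : ℕ) → Fin (p ^ α) → ℕ → Set
IsVal p α z v = v ≤ α × InMult p v z × (∀ j → j ≤ α → InMult p j z → j ≤ v)

I₁ : (p α : ℕ) → (Fin (p ^ α) → Bool) → ℕ → Set
I₁ p α X r = r ≤ α × (∀ i → InO p r i → ΔU X i ≡ 2)

I₂ : (p α : ℕ) → (Fin (p ^ α) → Bool) → ℕ → Set
I₂ p α X r = r ≤ α × (∀ i → InO p r i → ΔU X i ≡ 1)

InΓ : (p α : ℕ) → (Fin (p ^ α) → Bool) → ℕ → Fin (p ^ α) → Set
InΓ p α X m z = Eqζ p α (𝓕 (ΔU X) z) (const (Data.Integer.- (+ m)))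

IsMinVal : (p α : ℕ) → (Fin (p ^ α) → Bool) → ℕ → ℕ → Set
IsMinVal p α X m β =
  (∃ λ z → InΓ p α X m z × IsVal p α z β) ×
  (∀ z v → InΓ p α X m z → IsVal p α z v → β ≤ v)

-- "n is the multiplicity of an element in (A-indicator) ⊎ (B-indicator)",
-- i.e. n = 1_A + 1_B
MultSum : ℕ → Set → Set → Set
MultSum n A B =
  (A → B → n ≡ 2) × (A → ¬ B → n ≡ 1) × (¬ A → B → n ≡ 1) × (¬ A → ¬ B → n ≡ 0)

-- Write U = Δ_{U_X}, n = p^(a+1) and q = p^a. The coefficient of x^k in (𝓕U)(z) is the fibre sum
-- ∑_{iz = k} U(i), and every multiple of Φ_n is fixed by multiplication with x^q; so whenever (𝓕U)(z)
-- is an integer, the fibre sums over k and k + q agree unless one of k, k + q is 0. For z = p^j the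
-- fibres are residue classes modulo p^(a+1-j), and a descending induction makes U constant on each
-- orbit O_r. Then, going down from r = a, the frequency p^(a-r) compares U on p^(r+1)ℤ_n (the fibre
-- over 0) with U on the orbit of p^r (the fibre over q): while the transform is 0 there, vanishing on
-- p^(r+1)ℤ_n propagates to the orbit of p^r. As X ≠ -X this stops at a level r where the transform is
-- -m, which forces U ≥ 1 on the orbit of p^r; this r gives β = a - r, and the same comparison shows
-- that U ≥ 1, hence U ∈ {1, 2}, on every orbit of smaller valuation.

module Submission where

open import Defs
open import Data.Nat as ℕ
  using (ℕ; zero; suc; _+_; _*_; _∸_; _^_; _≤_; _<_; _%_; _/_; z≤n; s≤s; NonZero; >-nonZero; >-nonZero⁻¹; nonTrivial⇒n>1)
open import Data.Nat.Properties
open import Data.Nat.DivMod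
open import Data.Nat.Divisibility
open import Data.Nat.Primality using (Prime; prime⇒nonZero; prime⇒nonTrivial; euclidsLemma)
open import Data.Nat.Tactic.RingSolver using (solve-∀)
open import Data.Integer as ℤ using (ℤ; -_)
import Data.Integer.Properties as ℤP
open import Data.Fin as Fin using (Fin; zero; suc; toℕ; fromℕ<)
import Data.Fin.Properties as FinP
open import Data.Fin.Permutation using (Permutation; permutation)
open import Data.Bool using (Bool; true; false; if_then_else_)
open import Data.Product using (∃; _×_; _,_; proj₁; proj₂)
open import Data.Sum using (_⊎_; inj₁; inj₂; [_,_])
open import Data.Empty using (⊥; ⊥-elim)
open import Function using (_∘_; id; case_of_)
open import Function.Bundles using (_⇔_; mk⇔; Equivalence)
open import Relation.Nullary using (¬_; does; yes; no)
open import Relation.Binary.PropositionalEquality hiding ([_])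
import Algebra.Properties.CommutativeMonoid.Sum as CommutativeMonoidSum
import Algebra.Properties.Semiring.Sum as SemiringSum

module Sumℕ = CommutativeMonoidSum +-0-commutativeMonoid
module Sumℤ = CommutativeMonoidSum ℤP.+-0-commutativeMonoid
open Sumℕ using (sum)

∑≡sum : ∀ {N} (f : Fin N → ℤ) → ∑ f ≡ Sumℤ.sum f
∑≡sum {zero}  f = refl
∑≡sum {suc N} f = cong (λ t → f zero ℤ.+ t) (∑≡sum (f ∘ suc))

∑-cong : ∀ {N} {f g : Fin N → ℤ} → (∀ i → f i ≡ g i) → ∑ f ≡ ∑ g
∑-cong {f = f} {g} f≗g = trans (∑≡sum f) (trans (Sumℤ.sum-cong-≗ f≗g) (sym (∑≡sum g)))

∑-pos : ∀ {N} (f : Fin N → ℕ) → ∑ (λ i → ℤ.+ f i) ≡ ℤ.+ sum f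
∑-pos {zero}  f = refl
∑-pos {suc N} f = cong (λ t → ℤ.+ f zero ℤ.+ t) (∑-pos (f ∘ suc))

term≤sum : ∀ {N} (f : Fin N → ℕ) i → f i ≤ sum f
term≤sum f zero    = m≤m+n _ _
term≤sum f (suc i) = ≤-trans (term≤sum (f ∘ suc) i) (m≤n+m _ (f zero))

m∸n≤o⇒m∸o≤n : ∀ m n o → m ∸ n ≤ o → m ∸ o ≤ n
m∸n≤o⇒m∸o≤n m n o m∸n≤o = m≤n+o⇒m∸n≤o m o
  (≤-trans (m≤n+m∸n m n) (subst (n + (m ∸ n) ≤_) (+-comm n o) (+-monoʳ-≤ n m∸n≤o)))

[m%n+o]%n≡[m+o]%n : ∀ m o n .{{_ : NonZero n}} → (m % n + o) % n ≡ (m + o) % n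
[m%n+o]%n≡[m+o]%n m o n = begin
  (m % n + o) % n           ≡⟨ %-distribˡ-+ (m % n) o n ⟩
  (m % n % n + o % n) % n   ≡⟨ cong (λ t → (t + o % n) % n) (m%n%n≡m%n m n) ⟩
  (m % n + o % n) % n       ≡⟨ %-distribˡ-+ m o n ⟨
  (m + o) % n               ∎
  where open ≡-Reasoning

[m%n*o]%n≡[m*o]%n : ∀ m o n .{{_ : NonZero n}} → (m % n * o) % n ≡ (m * o) % n
[m%n*o]%n≡[m*o]%n m o n = begin
  (m % n * o) % n           ≡⟨ %-distribˡ-* (m % n) o n ⟩
  (m % n % n * (o % n)) % n ≡⟨ cong (λ t → (t * (o % n)) % n) (m%n%n≡m%n m n) ⟩
  (m % n * (o % n)) % n     ≡⟨ %-distribˡ-* m o n ⟨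
  (m * o) % n               ∎
  where open ≡-Reasoning

[m+n%o]%o≡[m+n]%o : ∀ m n o .{{_ : NonZero o}} → (m + n % o) % o ≡ (m + n) % o
[m+n%o]%o≡[m+n]%o m n o = begin
  (m + n % o) % o   ≡⟨ cong (_% o) (+-comm m (n % o)) ⟩
  (n % o + m) % o   ≡⟨ [m%n+o]%n≡[m+o]%n n m o ⟩
  (n + m) % o       ≡⟨ cong (_% o) (+-comm n m) ⟩
  (m + n) % o       ∎
  where open ≡-Reasoning

toℕ-ofℕ : ∀ {N} .{{_ : NonZero N}} (i : Fin N) x → toℕ (ofℕ i x) ≡ x % N
toℕ-ofℕ {suc N} i x = FinP.toℕ-fromℕ< _

module Residues (N : ℕ) .{{_ : NonZero N}} where

  el : ℕ → Fin N
  el x = fromℕ< (m%n<n x N)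

  toℕ-el : ∀ x → toℕ (el x) ≡ x % N
  toℕ-el x = FinP.toℕ-fromℕ< _

  toℕ%N : ∀ (i : Fin N) → toℕ i % N ≡ toℕ i
  toℕ%N i = m<n⇒m%n≡m (FinP.toℕ<n i)

  el-toℕ : ∀ (i : Fin N) → el (toℕ i) ≡ i
  el-toℕ i = FinP.toℕ-injective (trans (toℕ-el _) (toℕ%N i))

  toℕ-el-< : ∀ {x} → x < N → toℕ (el x) ≡ x
  toℕ-el-< x<N = trans (toℕ-el _) (m<n⇒m%n≡m x<N)

  el≡ : ∀ {x} (i : Fin N) → x % N ≡ toℕ i → el x ≡ i
  el≡ i e = FinP.toℕ-injective (trans (toℕ-el _) e)

  _⁻ : ℕ → ℕ
  d ⁻ = N ∸ d % N

  +⁻≡*N : ∀ d → d + d ⁻ ≡ suc (d / N) * N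
  +⁻≡*N d = begin
    d + (N ∸ d % N)                       ≡⟨ cong (_+ (N ∸ d % N)) (m≡m%n+[m/n]*n d N) ⟩
    d % N + d / N * N + (N ∸ d % N)       ≡⟨ cong (_+ (N ∸ d % N)) (+-comm (d % N) _) ⟩
    d / N * N + d % N + (N ∸ d % N)       ≡⟨ +-assoc (d / N * N) _ _ ⟩
    d / N * N + (d % N + (N ∸ d % N))     ≡⟨ cong (d / N * N +_) (m+[n∸m]≡n (m%n≤n d N)) ⟩
    d / N * N + N                         ≡⟨ +-comm _ N ⟩
    suc (d / N) * N                       ∎
    where open ≡-Reasoning

  [x+d]%N≡[y+d]%N⇒x%N≡y%N : ∀ x y d → (x + d) % N ≡ (y + d) % N → x % N ≡ y % N
  [x+d]%N≡[y+d]%N⇒x%N≡y%N x y d e = begin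
    x % N                           ≡⟨ lift x ⟨
    (x + d + d ⁻) % N               ≡⟨ [m%n+o]%n≡[m+o]%n (x + d) (d ⁻) N ⟨
    ((x + d) % N + d ⁻) % N         ≡⟨ cong (λ t → (t + d ⁻) % N) e ⟩
    ((y + d) % N + d ⁻) % N         ≡⟨ [m%n+o]%n≡[m+o]%n (y + d) (d ⁻) N ⟩
    (y + d + d ⁻) % N               ≡⟨ lift y ⟩
    y % N                           ∎
    where
    open ≡-Reasoning
    lift : ∀ z → (z + d + d ⁻) % N ≡ z % N
    lift z = trans (cong (_% N) (trans (+-assoc z d (d ⁻)) (cong (z +_) (+⁻≡*N d))))
                   ([m+kn]%n≡m%n z (suc (d / N)) N)

  shift : ℕ → Fin N → Fin N
  shift d i = el (toℕ i + d)

  toℕ-shift-shift : ∀ d e (i : Fin N) → toℕ (shift e (shift d i)) ≡ (toℕ i + (d + e)) % N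
  toℕ-shift-shift d e i = begin
    toℕ (shift e (shift d i))         ≡⟨ toℕ-el _ ⟩
    (toℕ (el (toℕ i + d)) + e) % N    ≡⟨ cong (λ t → (t + e) % N) (toℕ-el _) ⟩
    ((toℕ i + d) % N + e) % N         ≡⟨ [m%n+o]%n≡[m+o]%n (toℕ i + d) e N ⟩
    (toℕ i + d + e) % N               ≡⟨ cong (_% N) (+-assoc (toℕ i) d e) ⟩
    (toℕ i + (d + e)) % N             ∎
    where open ≡-Reasoning

  shift-by-multiple : ∀ d e k (i : Fin N) → d + e ≡ k * N → shift e (shift d i) ≡ i
  shift-by-multiple d e k i d+e≡kN = FinP.toℕ-injective (begin
    toℕ (shift e (shift d i))         ≡⟨ toℕ-shift-shift d e i ⟩
    (toℕ i + (d + e)) % N             ≡⟨ cong (λ t → (toℕ i + t) % N) d+e≡kN ⟩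
    (toℕ i + k * N) % N               ≡⟨ [m+kn]%n≡m%n (toℕ i) k N ⟩
    toℕ i % N                         ≡⟨ toℕ%N i ⟩
    toℕ i                             ∎)
    where open ≡-Reasoning

  shiftPermutation : ℕ → Permutation N N
  shiftPermutation d = permutation (shift d) (shift (d ⁻))
    (λ i → shift-by-multiple (d ⁻) d (suc (d / N)) i (trans (+-comm (d ⁻) d) (+⁻≡*N d)))
    (λ i → shift-by-multiple d (d ⁻) (suc (d / N)) i (+⁻≡*N d))

  sum-shift : ∀ d (f : Fin N → ℕ) → sum f ≡ sum (f ∘ shift d)
  sum-shift d f = Sumℕ.sum-permute f (shiftPermutation d)

  ∑-shift : ∀ d (f : Fin N → ℤ) → ∑ f ≡ ∑ (f ∘ shift d)
  ∑-shift d f = trans (∑≡sum f) (trans (Sumℤ.sum-permute f (shiftPermutation d)) (sym (∑≡sum (f ∘ shift d))))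

  toℕ-sub-+ : ∀ (k i : Fin N) → (toℕ (sub k i) + toℕ i) % N ≡ toℕ k
  toℕ-sub-+ k i = begin
    (toℕ (sub k i) + toℕ i) % N              ≡⟨ cong (λ t → (t + toℕ i) % N) (toℕ-ofℕ k _) ⟩
    ((toℕ k + (N ∸ toℕ i)) % N + toℕ i) % N  ≡⟨ [m%n+o]%n≡[m+o]%n (toℕ k + (N ∸ toℕ i)) (toℕ i) N ⟩
    (toℕ k + (N ∸ toℕ i) + toℕ i) % N        ≡⟨ cong (_% N) (+-assoc (toℕ k) _ _) ⟩
    (toℕ k + ((N ∸ toℕ i) + toℕ i)) % N      ≡⟨ cong (λ t → (toℕ k + t) % N) (m∸n+n≡m (<⇒≤ (FinP.toℕ<n i))) ⟩
    (toℕ k + N) % N                          ≡⟨ [m+n]%n≡m%n (toℕ k) N ⟩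
    toℕ k % N                                ≡⟨ toℕ%N k ⟩
    toℕ k                                    ∎
    where open ≡-Reasoning

  sub-shift : ∀ d (k i : Fin N) → sub (shift d k) (shift d i) ≡ sub k i
  sub-shift d k i = FinP.toℕ-injective (begin
    toℕ (sub (shift d k) (shift d i))       ≡⟨ toℕ%N _ ⟨
    toℕ (sub (shift d k) (shift d i)) % N   ≡⟨ [x+d]%N≡[y+d]%N⇒x%N≡y%N _ _ (toℕ i + d) shifted ⟩
    toℕ (sub k i) % N                       ≡⟨ toℕ%N _ ⟩
    toℕ (sub k i)                           ∎)
    where
    open ≡-Reasoning
    shifted : (toℕ (sub (shift d k) (shift d i)) + (toℕ i + d)) % N ≡ (toℕ (sub k i) + (toℕ i + d)) % N
    shifted = begin
      (toℕ (sub (shift d k) (shift d i)) + (toℕ i + d)) % N      ≡⟨ [m+n%o]%o≡[m+n]%o _ (toℕ i + d) N ⟨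
      (toℕ (sub (shift d k) (shift d i)) + (toℕ i + d) % N) % N
        ≡⟨ cong (λ t → (toℕ (sub (shift d k) (shift d i)) + t) % N) (toℕ-el _) ⟨
      (toℕ (sub (shift d k) (shift d i)) + toℕ (shift d i)) % N  ≡⟨ toℕ-sub-+ (shift d k) (shift d i) ⟩
      toℕ (shift d k)                                            ≡⟨ toℕ-el _ ⟩
      (toℕ k + d) % N                                            ≡⟨ cong (λ t → (t + d) % N) (toℕ-sub-+ k i) ⟨
      ((toℕ (sub k i) + toℕ i) % N + d) % N                      ≡⟨ [m%n+o]%n≡[m+o]%n _ d N ⟩
      (toℕ (sub k i) + toℕ i + d) % N                            ≡⟨ cong (_% N) (+-assoc (toℕ (sub k i)) (toℕ i) d) ⟩
      (toℕ (sub k i) + (toℕ i + d)) % N                          ∎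

  δ : Fin N → Fin N → ℕ
  δ u k = if does (u Fin.≟ k) then 1 else 0

  mono≡δ : ∀ u k → mono u k ≡ ℤ.+ δ u k
  mono≡δ u k with does (u Fin.≟ k)
  ... | true  = refl
  ... | false = refl

  δ-≡ : ∀ {u k} → toℕ u ≡ toℕ k → δ u k ≡ 1
  δ-≡ {u} {k} e with u Fin.≟ k
  ... | yes _  = refl
  ... | no u≢k = ⊥-elim (u≢k (FinP.toℕ-injective e))

  δ-≢ : ∀ {u k} → ¬ toℕ u ≡ toℕ k → δ u k ≡ 0
  δ-≢ {u} {k} ne with u Fin.≟ k
  ... | yes u≡k = ⊥-elim (ne (cong toℕ u≡k))
  ... | no _    = refl

  δ-cong : ∀ {u k u′ k′} → (toℕ u ≡ toℕ k) ⇔ (toℕ u′ ≡ toℕ k′) → δ u k ≡ δ u′ k′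
  δ-cong {u} {k} u≡k⇔u′≡k′ with toℕ u ℕ.≟ toℕ k
  ... | yes e = trans (δ-≡ e) (sym (δ-≡ (Equivalence.to u≡k⇔u′≡k′ e)))
  ... | no ne = trans (δ-≢ ne) (sym (δ-≢ (ne ∘ Equivalence.from u≡k⇔u′≡k′)))

  δ-shift : ∀ {u u′} d k → toℕ u′ ≡ (toℕ u + d) % N → δ u′ (shift d k) ≡ δ u k
  δ-shift {u} {u′} d k u′≡u+d = δ-cong (mk⇔ to from)
    where
    to : toℕ u′ ≡ toℕ (shift d k) → toℕ u ≡ toℕ k
    to e = trans (sym (toℕ%N u))
             (trans ([x+d]%N≡[y+d]%N⇒x%N≡y%N _ _ d (trans (sym u′≡u+d) (trans e (toℕ-el _)))) (toℕ%N k))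
    from : toℕ u ≡ toℕ k → toℕ u′ ≡ toℕ (shift d k)
    from e = trans u′≡u+d (trans (cong (λ t → (t + d) % N) e) (sym (toℕ-el _)))

  InFibre : Fin N → Fin N → Fin N → Set
  InFibre z k i = (toℕ i * toℕ z) % N ≡ toℕ k

  fibreSum : (Fin N → ℕ) → Fin N → Fin N → ℕ
  fibreSum B z k = sum (λ i → B i * δ (mul i z) k)

  fibreSize : Fin N → Fin N → ℕ
  fibreSize z k = sum (λ i → δ (mul i z) k)

  𝓕≡fibreSum : ∀ B z k → 𝓕 B z k ≡ ℤ.+ fibreSum B z k
  𝓕≡fibreSum B z k = begin
    𝓕 B z k                                      ≡⟨ ∑-cong (λ i → cong (ℤ.+ B i ℤ.*_) (mono≡δ (mul i z) k)) ⟩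
    ∑ (λ i → ℤ.+ B i ℤ.* ℤ.+ δ (mul i z) k)      ≡⟨ ∑-cong (λ i → ℤP.pos-* (B i) _) ⟨
    ∑ (λ i → ℤ.+ (B i * δ (mul i z) k))          ≡⟨ ∑-pos (λ i → B i * δ (mul i z) k) ⟩
    ℤ.+ fibreSum B z k                           ∎
    where open ≡-Reasoning

  δ-fibre : ∀ {z k} i → InFibre z k i → δ (mul i z) k ≡ 1
  δ-fibre i i∈ = δ-≡ (trans (toℕ-ofℕ i _) i∈)

  δ-nonfibre : ∀ {z k} i → ¬ InFibre z k i → δ (mul i z) k ≡ 0
  δ-nonfibre i i∉ = δ-≢ (λ e → i∉ (trans (sym (toℕ-ofℕ i _)) e))

  term≤fibreSum : ∀ B {z k} i → InFibre z k i → B i ≤ fibreSum B z k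
  term≤fibreSum B {z} {k} i i∈ =
    subst (_≤ fibreSum B z k) (trans (cong (B i *_) (δ-fibre i i∈)) (*-identityʳ (B i))) (term≤sum _ i)

  fibreSize-nonZero : ∀ {z k} i → InFibre z k i → NonZero (fibreSize z k)
  fibreSize-nonZero {z} {k} i i∈ = >-nonZero (subst (_≤ fibreSize z k) (δ-fibre i i∈) (term≤sum _ i))

  fibreSum-const : ∀ B {z k} c → (∀ i → InFibre z k i → B i ≡ c) → fibreSum B z k ≡ c * fibreSize z k
  fibreSum-const B {z} {k} c B≡c =
    trans (Sumℕ.sum-cong-≗ term) (sym (SemiringSum.*-distribˡ-sum +-*-semiring c (λ i → δ (mul i z) k)))
    where
    term : ∀ i → B i * δ (mul i z) k ≡ c * δ (mul i z) k
    term i with (toℕ i * toℕ z) % N ℕ.≟ toℕ k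
    ... | yes i∈ = cong (_* δ (mul i z) k) (B≡c i i∈)
    ... | no i∉  = begin
      B i * δ (mul i z) k   ≡⟨ cong (B i *_) (δ-nonfibre i i∉) ⟩
      B i * 0               ≡⟨ *-zeroʳ (B i) ⟩
      0                     ≡⟨ *-zeroʳ c ⟨
      c * 0                 ≡⟨ cong (c *_) (δ-nonfibre i i∉) ⟨
      c * δ (mul i z) k     ∎
      where open ≡-Reasoning

  fibreSum-shift : ∀ B z k d → fibreSum B z (shift (toℕ z * d) k) ≡ fibreSum (B ∘ shift d) z k
  fibreSum-shift B z k d =
    trans (sum-shift d _) (Sumℕ.sum-cong-≗ λ i → cong (B (shift d i) *_) (δ-shift (toℕ z * d) k (toℕ-mul-shift i)))
    where
    open ≡-Reasoning
    toℕ-mul-shift : ∀ i → toℕ (mul (shift d i) z) ≡ (toℕ (mul i z) + toℕ z * d) % N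
    toℕ-mul-shift i = begin
      toℕ (mul (shift d i) z)              ≡⟨ toℕ-ofℕ (shift d i) _ ⟩
      (toℕ (shift d i) * toℕ z) % N        ≡⟨ cong (λ t → (t * toℕ z) % N) (toℕ-el _) ⟩
      ((toℕ i + d) % N * toℕ z) % N        ≡⟨ [m%n*o]%n≡[m*o]%n (toℕ i + d) (toℕ z) N ⟩
      ((toℕ i + d) * toℕ z) % N            ≡⟨ cong (_% N) (trans (*-distribʳ-+ (toℕ z) (toℕ i) d)
                                                            (cong (toℕ i * toℕ z +_) (*-comm d (toℕ z)))) ⟩
      (toℕ i * toℕ z + toℕ z * d) % N      ≡⟨ [m%n+o]%n≡[m+o]%n _ (toℕ z * d) N ⟨
      ((toℕ i * toℕ z) % N + toℕ z * d) % N ≡⟨ cong (λ t → (t + toℕ z * d) % N) (toℕ-ofℕ i _) ⟨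
      (toℕ (mul i z) + toℕ z * d) % N      ∎

  fibre-values-agree : ∀ B z k d {b₀ b₁} → fibreSum B z k ≡ fibreSum B z (shift (toℕ z * d) k) →
    (∀ i → InFibre z k i → B i ≡ b₀) → (∀ i → InFibre z k i → B (shift d i) ≡ b₁) →
    ∀ i → InFibre z k i → b₀ ≡ b₁
  fibre-values-agree B z k d {b₀} {b₁} periodic B≡b₀ B∘shift≡b₁ i i∈ =
    *-cancelʳ-≡ b₀ b₁ (fibreSize z k) {{fibreSize-nonZero i i∈}} (begin
      b₀ * fibreSize z k                    ≡⟨ fibreSum-const B b₀ B≡b₀ ⟨
      fibreSum B z k                        ≡⟨ periodic ⟩
      fibreSum B z (shift (toℕ z * d) k)    ≡⟨ fibreSum-shift B z k d ⟩
      fibreSum (B ∘ shift d) z k            ≡⟨ fibreSum-const (B ∘ shift d) b₁ B∘shift≡b₁ ⟩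
      b₁ * fibreSize z k                    ∎)
    where open ≡-Reasoning

module Cyclotomic (p a : ℕ) .{{_ : NonZero p}} where

  n q : ℕ
  n = p ^ suc a
  q = p ^ a

  instance
    n-nonZero : NonZero n
    n-nonZero = m^n≢0 p (suc a)

  open Residues n
  private module ℤₚ = Residues p

  cyclo-periodic : ∀ k → cyclo p (suc a) (shift q k) ≡ cyclo p (suc a) k
  cyclo-periodic k = trans (ℤₚ.∑-shift 1 _) (∑-cong λ j → begin
    mono (ofℕ (shift q k) (toℕ (ℤₚ.shift 1 j) * q)) (shift q k)
      ≡⟨ mono≡δ (ofℕ (shift q k) (toℕ (ℤₚ.shift 1 j) * q)) (shift q k) ⟩
    ℤ.+ δ (ofℕ (shift q k) (toℕ (ℤₚ.shift 1 j) * q)) (shift q k) ≡⟨ cong ℤ.+_ (δ-shift q k (toℕ-term j)) ⟩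
    ℤ.+ δ (ofℕ k (toℕ j * q)) k                                   ≡⟨ mono≡δ (ofℕ k (toℕ j * q)) k ⟨
    mono (ofℕ k (toℕ j * q)) k                                    ∎)
    where
    open ≡-Reasoning
    toℕ-term : ∀ j → toℕ (ofℕ (shift q k) (toℕ (ℤₚ.shift 1 j) * q)) ≡ (toℕ (ofℕ k (toℕ j * q)) + q) % n
    toℕ-term j = begin
      toℕ (ofℕ (shift q k) (toℕ (ℤₚ.shift 1 j) * q)) ≡⟨ toℕ-ofℕ (shift q k) _ ⟩
      (toℕ (ℤₚ.shift 1 j) * q) % n                   ≡⟨ cong (λ t → (t * q) % n) (ℤₚ.toℕ-el _) ⟩
      ((toℕ j + 1) % p * q) % n                      ≡⟨ cong (_% n) (m%n*o≡m*o%[n*o] (toℕ j + 1) p q) ⟩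
      ((toℕ j + 1) * q) % n % n                      ≡⟨ m%n%n≡m%n _ n ⟩
      ((toℕ j + 1) * q) % n                          ≡⟨ cong (_% n) (trans (*-distribʳ-+ q (toℕ j) 1)
                                                                       (cong (toℕ j * q +_) (*-identityˡ q))) ⟩
      (toℕ j * q + q) % n                            ≡⟨ [m%n+o]%n≡[m+o]%n (toℕ j * q) q n ⟨
      ((toℕ j * q) % n + q) % n                      ≡⟨ cong (λ t → (t + q) % n) (toℕ-ofℕ k _) ⟨
      (toℕ (ofℕ k (toℕ j * q)) + q) % n              ∎

  conv-cyclo-periodic : ∀ h k → conv (cyclo p (suc a)) h (shift q k) ≡ conv (cyclo p (suc a)) h k
  conv-cyclo-periodic h k = trans (∑-shift q _) (∑-cong λ i →
    cong₂ ℤ._*_ (cyclo-periodic i) (cong h (sub-shift q k i)))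

  -- Φ(x) = ∑ⱼ x^(j q) is fixed by multiplication with x^q, hence so is every multiple of Φ.
  Eqζ-periodic : ∀ f g → Eqζ p (suc a) f g → ∀ k → f k ℤ.- g k ≡ f (shift q k) ℤ.- g (shift q k)
  Eqζ-periodic f g (h , f-g≡Φh) k = trans (f-g≡Φh k) (trans (sym (conv-cyclo-periodic h k)) (sym (f-g≡Φh (shift q k))))

  toℕ-ofℕ-0 : ∀ (k : Fin n) → toℕ (ofℕ k 0) ≡ 0
  toℕ-ofℕ-0 k = trans (toℕ-ofℕ k 0) (m<n⇒m%n≡m (>-nonZero⁻¹ n))

  const-at-0 : ∀ c (k : Fin n) → toℕ k ≡ 0 → const c k ≡ c
  const-at-0 c k k≡0 =
    trans (cong (c ℤ.*_) (trans (mono≡δ (ofℕ k 0) k) (cong ℤ.+_ (δ-≡ (trans (toℕ-ofℕ-0 k) (sym k≡0))))))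
                             (ℤP.*-identityʳ c)

  const-off-0 : ∀ c (k : Fin n) → ¬ toℕ k ≡ 0 → const c k ≡ ℤ.+ 0
  const-off-0 c k k≢0 =
    trans (cong (c ℤ.*_) (trans (mono≡δ (ofℕ k 0) k) (cong ℤ.+_ (δ-≢ (λ e → k≢0 (trans (sym e) (toℕ-ofℕ-0 k)))))))
                              (ℤP.*-zeroʳ c)

  fibreSum-periodic : ∀ B z c → Eqζ p (suc a) (𝓕 B z) (const c) → ∀ k →
    ℤ.+ fibreSum B z k ℤ.- const c k ≡ ℤ.+ fibreSum B z (shift q k) ℤ.- const c (shift q k)
  fibreSum-periodic B z c 𝓕≈c k = subst₂ (λ l r → l ℤ.- const c k ≡ r ℤ.- const c (shift q k))
    (𝓕≡fibreSum B z k) (𝓕≡fibreSum B z (shift q k)) (Eqζ-periodic (𝓕 B z) (const c) 𝓕≈c k)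

  fibreSum-periodic-off-0 : ∀ B z c → Eqζ p (suc a) (𝓕 B z) (const c) →
    ∀ k → ¬ toℕ k ≡ 0 → ¬ toℕ (shift q k) ≡ 0 →
    fibreSum B z k ≡ fibreSum B z (shift q k)
  fibreSum-periodic-off-0 B z c 𝓕≈c k k≢0 k+q≢0 = ℤP.+-injective (begin
    ℤ.+ fibreSum B z k                                       ≡⟨ ℤP.+-identityʳ _ ⟨
    ℤ.+ fibreSum B z k ℤ.- ℤ.+ 0                             ≡⟨ cong (ℤ._-_ (ℤ.+ fibreSum B z k)) (const-off-0 c k k≢0) ⟨
    ℤ.+ fibreSum B z k ℤ.- const c k                         ≡⟨ fibreSum-periodic B z c 𝓕≈c k ⟩
    ℤ.+ fibreSum B z (shift q k) ℤ.- const c (shift q k)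
      ≡⟨ cong (ℤ._-_ (ℤ.+ fibreSum B z (shift q k))) (const-off-0 c _ k+q≢0) ⟩
    ℤ.+ fibreSum B z (shift q k) ℤ.- ℤ.+ 0                   ≡⟨ ℤP.+-identityʳ _ ⟩
    ℤ.+ fibreSum B z (shift q k)                             ∎)
    where open ≡-Reasoning

  fibreSum-jump-at-0 : ∀ B z c → Eqζ p (suc a) (𝓕 B z) (const c) → ∀ k → toℕ k ≡ 0 → ¬ toℕ (shift q k) ≡ 0 →
    ℤ.+ fibreSum B z k ℤ.- c ≡ ℤ.+ fibreSum B z (shift q k)
  fibreSum-jump-at-0 B z c 𝓕≈c k k≡0 k+q≢0 = begin
    ℤ.+ fibreSum B z k ℤ.- c                                 ≡⟨ cong (ℤ._-_ (ℤ.+ fibreSum B z k)) (const-at-0 c k k≡0) ⟨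
    ℤ.+ fibreSum B z k ℤ.- const c k                         ≡⟨ fibreSum-periodic B z c 𝓕≈c k ⟩
    ℤ.+ fibreSum B z (shift q k) ℤ.- const c (shift q k)
      ≡⟨ cong (ℤ._-_ (ℤ.+ fibreSum B z (shift q k))) (const-off-0 c _ k+q≢0) ⟩
    ℤ.+ fibreSum B z (shift q k) ℤ.- ℤ.+ 0                   ≡⟨ ℤP.+-identityʳ _ ⟩
    ℤ.+ fibreSum B z (shift q k)                             ∎
    where open ≡-Reasoning

module PrimePowers (p : ℕ) (pr : Prime p) where

  instance
    p-nonZero : NonZero p
    p-nonZero = prime⇒nonZero pr

  infixl 7 _%p^_
  _%p^_ : ℕ → ℕ → ℕ
  x %p^ e = _%_ x (p ^ e) {{m^n≢0 p e}}

  1<p : 1 < p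
  1<p = nonTrivial⇒n>1 p {{prime⇒nonTrivial pr}}

  p^-∣-mono : ∀ {e e′} → e ≤ e′ → p ^ e ∣ p ^ e′
  p^-∣-mono {e} {e′} e≤e′ = divides (p ^ (e′ ∸ e))
    (trans (cong (p ^_) (sym (m∸n+n≡m e≤e′))) (^-distribˡ-+-* p (e′ ∸ e) e))

  p^-∣⇒≤ : ∀ j e → p ^ j ∣ p ^ e → j ≤ e
  p^-∣⇒≤ j e d with j ℕ.≤? e
  ... | yes j≤e = j≤e
  ... | no j≰e  = ⊥-elim (<⇒≱ (^-monoʳ-< p 1<p (≰⇒> j≰e)) (∣⇒≤ {{m^n≢0 p e}} d))

  p^-∣-cancel-coprime : ∀ e i {w} → ¬ p ∣ w → p ^ e ∣ i * w → p ^ e ∣ i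
  p^-∣-cancel-coprime zero    i _   _ = 1∣ i
  p^-∣-cancel-coprime (suc e) i {w} p∤w d with euclidsLemma i w pr (∣-trans (m∣m*n (p ^ e)) d)
  ... | inj₂ p∣w = ⊥-elim (p∤w p∣w)
  ... | inj₁ (divides t refl) = subst (p ^ suc e ∣_) (*-comm p t)
    (*-monoʳ-∣ p (p^-∣-cancel-coprime e t p∤w (*-cancelˡ-∣ p (subst (p * p ^ e ∣_) t*p*w≡p*[t*w] d))))
    where
    t*p*w≡p*[t*w] : t * p * w ≡ p * (t * w)
    t*p*w≡p*[t*w] = trans (cong (_* w) (*-comm t p)) (*-assoc p t w)

  HasValuation : ℕ → ℕ → Set
  HasValuation v x = p ^ v ∣ x × ¬ p ^ suc v ∣ x

  valuation-< : ∀ t x → ¬ p ^ t ∣ x → ∃ λ v → v < t × HasValuation v x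
  valuation-< zero    x p⁰∤x = ⊥-elim (p⁰∤x (1∣ x))
  valuation-< (suc t) x p^t+1∤x with p ^ t ∣? x
  ... | yes p^t∣x = t , ≤-refl , p^t∣x , p^t+1∤x
  ... | no p^t∤x with valuation-< t x p^t∤x
  ...   | v , v<t , val = v , m<n⇒m<1+n v<t , val

  digit-valuation : ∀ r {c} → 1 ≤ c → c < p → HasValuation r (c * p ^ r)
  digit-valuation r {suc c} _ c<p = n∣m*n (suc c) , λ d → <⇒≱ c<p (∣⇒≤ (*-cancelʳ-∣ {p} (p ^ r) {{m^n≢0 p r}} d))

module PrimePowerResidues (p a : ℕ) (pr : Prime p) where

  open PrimePowers p pr public
  open Cyclotomic p a public
  open Residues n public

  n≡p^*p^ : ∀ j e → j + e ≡ suc a → n ≡ p ^ j * p ^ e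
  n≡p^*p^ j e j+e≡a+1 = trans (cong (p ^_) (sym j+e≡a+1)) (^-distribˡ-+-* p j e)

  p^∣n : ∀ {e} → e ≤ suc a → p ^ e ∣ n
  p^∣n {e} e≤a+1 = divides (p ^ (suc a ∸ e)) (trans (n≡p^*p^ e (suc a ∸ e) (m+[n∸m]≡n e≤a+1)) (*-comm (p ^ e) _))

  p^∣%n⇔p^∣ : ∀ {e} x → e ≤ suc a → p ^ e ∣ x % n ⇔ p ^ e ∣ x
  p^∣%n⇔p^∣ x e≤a+1 = mk⇔ (∣n∣m%n⇒∣m (p^∣n e≤a+1)) (λ d → %-presˡ-∣ d (p^∣n e≤a+1))

  %n%p^ : ∀ {e} x → e ≤ suc a → x % n %p^ e ≡ x %p^ e
  %n%p^ {e} x e≤a+1 = m∣n⇒o%n%m≡o%m (p ^ e) n x {{m^n≢0 p e}} (p^∣n e≤a+1)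

  *p^%n : ∀ j e → j + e ≡ suc a → ∀ u → (u * p ^ j) % n ≡ u %p^ e * p ^ j
  *p^%n j e j+e≡a+1 u = sym (begin
    u %p^ e * p ^ j                   ≡⟨ m%n*o≡m*o%[n*o] u (p ^ e) (p ^ j) {{m^n≢0 p e}} {{nonZero-e*j}} ⟩
    _%_ (u * p ^ j) (p ^ e * p ^ j) {{nonZero-e*j}}  ≡⟨ %-congʳ {{nonZero-e*j}} {{n-nonZero}} e*j≡n ⟩
    (u * p ^ j) % n                   ∎)
    where
    open ≡-Reasoning
    nonZero-e*j : NonZero (p ^ e * p ^ j)
    nonZero-e*j = m*n≢0 (p ^ e) (p ^ j) {{m^n≢0 p e}} {{m^n≢0 p j}}
    e*j≡n : p ^ e * p ^ j ≡ n
    e*j≡n = trans (*-comm (p ^ e) (p ^ j)) (sym (n≡p^*p^ j e j+e≡a+1))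

  *p^%n≡0⇒p^∣ : ∀ j e → j + e ≡ suc a → ∀ u → (u * p ^ j) % n ≡ 0 → p ^ e ∣ u
  *p^%n≡0⇒p^∣ j e j+e≡a+1 u ≡0 = m%n≡0⇒n∣m u (p ^ e) {{m^n≢0 p e}}
    (m*n≡0⇒m≡0 _ (p ^ j) {{m^n≢0 p j}} (trans (sym (*p^%n j e j+e≡a+1 u)) ≡0))

  *p^%n-injective : ∀ j e → j + e ≡ suc a → ∀ u v → (u * p ^ j) % n ≡ (v * p ^ j) % n → u %p^ e ≡ v %p^ e
  *p^%n-injective j e j+e≡a+1 u v eq = *-cancelʳ-≡ _ _ (p ^ j) {{m^n≢0 p j}}
    (trans (sym (*p^%n j e j+e≡a+1 u)) (trans eq (*p^%n j e j+e≡a+1 v)))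

  shift-cong-%p^ : ∀ {e} d (x y : Fin n) → e ≤ suc a → toℕ x %p^ e ≡ toℕ y %p^ e →
    toℕ (shift d x) %p^ e ≡ toℕ (shift d y) %p^ e
  shift-cong-%p^ {e} d x y e≤a+1 x≡y = begin
    toℕ (shift d x) %p^ e         ≡⟨ cong (_%p^ e) (toℕ-el _) ⟩
    (toℕ x + d) % n %p^ e         ≡⟨ %n%p^ (toℕ x + d) e≤a+1 ⟩
    (toℕ x + d) %p^ e             ≡⟨ [m%n+o]%n≡[m+o]%n (toℕ x) d (p ^ e) {{m^n≢0 p e}} ⟨
    (toℕ x %p^ e + d) %p^ e       ≡⟨ cong (λ t → (t + d) %p^ e) x≡y ⟩
    (toℕ y %p^ e + d) %p^ e       ≡⟨ [m%n+o]%n≡[m+o]%n (toℕ y) d (p ^ e) {{m^n≢0 p e}} ⟩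
    (toℕ y + d) %p^ e             ≡⟨ %n%p^ (toℕ y + d) e≤a+1 ⟨
    (toℕ y + d) % n %p^ e         ≡⟨ cong (_%p^ e) (toℕ-el _) ⟨
    toℕ (shift d y) %p^ e         ∎
    where open ≡-Reasoning

  pow : ℕ → Fin n
  pow r = el (p ^ r)

  toℕ-pow : ∀ {r} → r ≤ a → toℕ (pow r) ≡ p ^ r
  toℕ-pow r≤a = toℕ-el-< (^-monoʳ-< p 1<p (s≤s r≤a))

  pow-valuation : ∀ {r} → r ≤ a → HasValuation r (toℕ (pow r))
  pow-valuation {r} r≤a = subst (HasValuation r) (sym (toℕ-pow r≤a))
    (∣-refl , λ d → 1+n≰n (p^-∣⇒≤ (suc r) r d))

  pow≢0 : ∀ {r} → r ≤ a → ¬ toℕ (pow r) ≡ 0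
  pow≢0 {r} r≤a ≡0 = <⇒≢ (m^n>0 p r) (sym (trans (sym (toℕ-pow r≤a)) ≡0))

  m+[1+s]≡1+a⇒m+s≡a : ∀ j s → j + suc s ≡ suc a → j + s ≡ a
  m+[1+s]≡1+a⇒m+s≡a j s j+s+1≡a+1 = suc-injective (trans (sym (+-suc j s)) j+s+1≡a+1)

  m+[1+s]≡1+a⇒m≤a : ∀ j s → j + suc s ≡ suc a → j ≤ a
  m+[1+s]≡1+a⇒m≤a j s j+s+1≡a+1 = m+n≤o⇒m≤o j (≤-reflexive (m+[1+s]≡1+a⇒m+s≡a j s j+s+1≡a+1))

  m+[1+s]≡1+a⇒s≤a : ∀ j s → j + suc s ≡ suc a → s ≤ a
  m+[1+s]≡1+a⇒s≤a j s j+s+1≡a+1 = m+n≤o⇒n≤o j (≤-reflexive (m+[1+s]≡1+a⇒m+s≡a j s j+s+1≡a+1))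

  pow-in-own-fibre : ∀ {j} (x : Fin n) → j ≤ a → InFibre (pow j) (el (toℕ x * p ^ j)) x
  pow-in-own-fibre {j} x j≤a = trans (cong (λ t → (toℕ x * t) % n) (toℕ-pow j≤a)) (sym (toℕ-el _))

  fibre-of-pow⇒*p^ : ∀ {j k} (i : Fin n) → j ≤ a → InFibre (pow j) k i → (toℕ i * p ^ j) % n ≡ toℕ k
  fibre-of-pow⇒*p^ {j} i j≤a = subst (λ t → (toℕ i * t) % n ≡ _) (toℕ-pow j≤a)

  *p^⇒fibre-of-pow : ∀ {j k} (i : Fin n) → j ≤ a → (toℕ i * p ^ j) % n ≡ toℕ k → InFibre (pow j) k i
  *p^⇒fibre-of-pow {j} i j≤a = subst (λ t → (toℕ i * t) % n ≡ _) (sym (toℕ-pow j≤a))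

  fibre-of-pow-class : ∀ j s → j + suc s ≡ suc a → ∀ y (i : Fin n) →
    InFibre (pow j) (el (y * p ^ j)) i → toℕ i %p^ suc s ≡ y %p^ suc s
  fibre-of-pow-class j s j+s+1≡a+1 y i i∈ = *p^%n-injective j (suc s) j+s+1≡a+1 (toℕ i) y
    (trans (fibre-of-pow⇒*p^ i (m+[1+s]≡1+a⇒m≤a j s j+s+1≡a+1) i∈) (toℕ-el _))

  zeroₙ : Fin n
  zeroₙ = el 0

  toℕ-zeroₙ : toℕ zeroₙ ≡ 0
  toℕ-zeroₙ = toℕ-el-< (>-nonZero⁻¹ n)

  qₙ : Fin n
  qₙ = shift q zeroₙ

  toℕ-qₙ : toℕ qₙ ≡ q
  toℕ-qₙ = trans (toℕ-el _) (trans (cong (λ t → (t + q) % n) toℕ-zeroₙ) (m<n⇒m%n≡m (^-monoʳ-< p 1<p (n<1+n a))))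

  qₙ≢0 : ¬ toℕ qₙ ≡ 0
  qₙ≢0 ≡0 = <⇒≢ (m^n>0 p a) (sym (trans (sym toℕ-qₙ) ≡0))

  fibre-of-pow-over-0 : ∀ j s → j + suc s ≡ suc a → ∀ (i : Fin n) → InFibre (pow j) zeroₙ i → p ^ suc s ∣ toℕ i
  fibre-of-pow-over-0 j s j+s+1≡a+1 i i∈ = *p^%n≡0⇒p^∣ j (suc s) j+s+1≡a+1 (toℕ i)
    (trans (fibre-of-pow⇒*p^ i (m+[1+s]≡1+a⇒m≤a j s j+s+1≡a+1) i∈) toℕ-zeroₙ)

  pow-in-fibre-over-0 : ∀ {j r} → j ≤ a → r ≤ a → suc a ≤ r + j → InFibre (pow j) zeroₙ (pow r)
  pow-in-fibre-over-0 {j} {r} j≤a r≤a a+1≤r+j = *p^⇒fibre-of-pow (pow r) j≤a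
    (trans (cong (λ t → (t * p ^ j) % n) (toℕ-pow r≤a))
      (trans (n∣m⇒m%n≡0 _ n (subst (n ∣_) (^-distribˡ-+-* p r j) (p^-∣-mono a+1≤r+j))) (sym toℕ-zeroₙ)))

  pow-in-fibre-over-q : ∀ j r → j + r ≡ a → InFibre (pow j) qₙ (pow r)
  pow-in-fibre-over-q j r j+r≡a = *p^⇒fibre-of-pow (pow r) (m+n≤o⇒m≤o j (≤-reflexive j+r≡a)) (begin
    (toℕ (pow r) * p ^ j) % n    ≡⟨ cong (λ t → (t * p ^ j) % n) (toℕ-pow (m+n≤o⇒n≤o j (≤-reflexive j+r≡a))) ⟩
    (p ^ r * p ^ j) % n          ≡⟨ cong (_% n) (trans (sym (^-distribˡ-+-* p r j)) (cong (p ^_) (trans (+-comm r j) j+r≡a))) ⟩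
    q % n                        ≡⟨ m<n⇒m%n≡m (^-monoʳ-< p 1<p (n<1+n a)) ⟩
    q                            ≡⟨ toℕ-qₙ ⟨
    toℕ qₙ                       ∎)
    where open ≡-Reasoning

  fibre-over-q-valuation : ∀ {v} z (i : Fin n) → v ≤ a → HasValuation v (toℕ z) → InFibre z qₙ i →
    HasValuation (a ∸ v) (toℕ i)
  fibre-over-q-valuation {v} z i v≤a (divides w z≡w*p^v , p^v+1∤z) i∈ = p^a-v∣i , p^a-v+1∤i
    where
    p∤w : ¬ p ∣ w
    p∤w p∣w = p^v+1∤z (subst (p ^ suc v ∣_) (sym z≡w*p^v) (*-monoˡ-∣ (p ^ v) p∣w))
    iz≡i*w*p^v : toℕ i * toℕ z ≡ toℕ i * w * p ^ v
    iz≡i*w*p^v = trans (cong (toℕ i *_) z≡w*p^v) (sym (*-assoc (toℕ i) w (p ^ v)))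
    q≡p^a-v*p^v : q ≡ p ^ (a ∸ v) * p ^ v
    q≡p^a-v*p^v = trans (cong (p ^_) (sym (m∸n+n≡m v≤a))) (^-distribˡ-+-* p (a ∸ v) v)
    q∣iz : q ∣ toℕ i * toℕ z
    q∣iz = ∣n∣m%n⇒∣m (p^∣n (n≤1+n a)) (subst (q ∣_) (sym (trans i∈ toℕ-qₙ)) ∣-refl)
    p^a-v∣i : p ^ (a ∸ v) ∣ toℕ i
    p^a-v∣i = p^-∣-cancel-coprime (a ∸ v) (toℕ i) p∤w
      (*-cancelʳ-∣ (p ^ v) {{m^n≢0 p v}} (subst₂ _∣_ q≡p^a-v*p^v iz≡i*w*p^v q∣iz))
    p^a-v+1∤i : ¬ p ^ suc (a ∸ v) ∣ toℕ i
    p^a-v+1∤i d = qₙ≢0 (trans (sym i∈) (n∣m⇒m%n≡0 _ n (subst₂ _∣_ p^a-v+1*p^v≡n (sym iz≡i*w*p^v)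
      (*-pres-∣ (∣-trans d (m∣m*n w)) ∣-refl))))
      where
      p^a-v+1*p^v≡n : p ^ suc (a ∸ v) * p ^ v ≡ n
      p^a-v+1*p^v≡n = trans (sym (^-distribˡ-+-* p (suc (a ∸ v)) v)) (cong (λ t → p ^ suc t) (m∸n+n≡m v≤a))

  toℕ-smul : ∀ k (i : Fin n) → toℕ (smul k i) ≡ (k * toℕ i) % n
  toℕ-smul k i = toℕ-ofℕ i _

  InMult⇔p^∣ : ∀ {j} (i : Fin n) → j ≤ suc a → InMult p j i ⇔ p ^ j ∣ toℕ i
  InMult⇔p^∣ {j} i j≤a+1 = mk⇔ to from
    where
    open ≡-Reasoning
    to : InMult p j i → p ^ j ∣ toℕ i
    to (y , p^j·y≡i) = subst (λ t → p ^ j ∣ toℕ t) p^j·y≡i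
      (subst (p ^ j ∣_) (sym (toℕ-smul (p ^ j) y)) (Equivalence.from (p^∣%n⇔p^∣ _ j≤a+1) (m∣m*n (toℕ y))))
    from : p ^ j ∣ toℕ i → InMult p j i
    from (divides w i≡w*p^j) = el w , FinP.toℕ-injective (begin
      toℕ (smul (p ^ j) (el w))     ≡⟨ toℕ-smul (p ^ j) (el w) ⟩
      (p ^ j * toℕ (el w)) % n      ≡⟨ cong (λ t → (p ^ j * t) % n) (toℕ-el w) ⟩
      (p ^ j * (w % n)) % n         ≡⟨ cong (_% n) (*-comm (p ^ j) _) ⟩
      (w % n * p ^ j) % n           ≡⟨ [m%n*o]%n≡[m*o]%n w (p ^ j) n ⟩
      (w * p ^ j) % n               ≡⟨ cong (_% n) i≡w*p^j ⟨
      toℕ i % n                     ≡⟨ toℕ%N i ⟩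
      toℕ i                         ∎)

  valuation⇒IsVal : ∀ {v} z → v ≤ a → HasValuation v (toℕ z) → IsVal p (suc a) z v
  valuation⇒IsVal {v} z v≤a (p^v∣z , p^v+1∤z) =
    m≤n⇒m≤1+n v≤a , Equivalence.from (InMult⇔p^∣ z (m≤n⇒m≤1+n v≤a)) p^v∣z , maximal
    where
    maximal : ∀ j → j ≤ suc a → InMult p j z → j ≤ v
    maximal j j≤a+1 p^j∣z with j ℕ.≤? v
    ... | yes j≤v = j≤v
    ... | no j≰v  = ⊥-elim (p^v+1∤z (∣-trans (p^-∣-mono (≰⇒> j≰v)) (Equivalence.to (InMult⇔p^∣ z j≤a+1) p^j∣z)))

  IsVal⇒valuation : ∀ {v} z → v ≤ a → IsVal p (suc a) z v → HasValuation v (toℕ z)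
  IsVal⇒valuation {v} z v≤a (v≤a+1 , p^v∣z , maximal) =
    Equivalence.to (InMult⇔p^∣ z v≤a+1) p^v∣z ,
    λ d → 1+n≰n (maximal (suc v) (s≤s v≤a) (Equivalence.from (InMult⇔p^∣ z (s≤s v≤a)) d))

  InO-intro : ∀ r (i : Fin n) → n ∣ p ^ r * toℕ i → (∀ k → n ∣ k * toℕ i → p ^ r ∣ k) → InO p r i
  InO-intro r i n∣p^r*i minimal = trans (toℕ-smul (p ^ r) i) (n∣m⇒m%n≡0 _ n n∣p^r*i) ,
    λ k 0<k k<p^r k·i≡0 →
      <⇒≱ k<p^r (∣⇒≤ {{>-nonZero 0<k}} (minimal k (m%n≡0⇒n∣m _ n (trans (sym (toℕ-smul k i)) k·i≡0))))

  valuation⇒InO : ∀ {v} (i : Fin n) → v ≤ a → HasValuation v (toℕ i) → InO p (suc (a ∸ v)) i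
  valuation⇒InO {v} i v≤a (divides w i≡w*p^v , p^v+1∤i) = InO-intro r i n∣p^r*i minimal
    where
    r = suc (a ∸ v)
    n≡p^r*p^v : n ≡ p ^ r * p ^ v
    n≡p^r*p^v = n≡p^*p^ r v (cong suc (m∸n+n≡m v≤a))
    p∤w : ¬ p ∣ w
    p∤w p∣w = p^v+1∤i (subst (p ^ suc v ∣_) (sym i≡w*p^v) (*-monoˡ-∣ (p ^ v) p∣w))
    n∣p^r*i : n ∣ p ^ r * toℕ i
    n∣p^r*i = subst₂ _∣_ (sym n≡p^r*p^v) (begin
      w * (p ^ r * p ^ v)     ≡⟨ *-assoc w (p ^ r) (p ^ v) ⟨
      w * p ^ r * p ^ v       ≡⟨ cong (_* p ^ v) (*-comm w (p ^ r)) ⟩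
      p ^ r * w * p ^ v       ≡⟨ *-assoc (p ^ r) w (p ^ v) ⟩
      p ^ r * (w * p ^ v)     ≡⟨ cong (p ^ r *_) i≡w*p^v ⟨
      p ^ r * toℕ i           ∎) (n∣m*n w)
      where open ≡-Reasoning
    minimal : ∀ k → n ∣ k * toℕ i → p ^ r ∣ k
    minimal k n∣k*i = p^-∣-cancel-coprime r k p∤w (*-cancelʳ-∣ (p ^ v) {{m^n≢0 p v}}
      (subst₂ _∣_ n≡p^r*p^v (trans (cong (k *_) i≡w*p^v) (sym (*-assoc k w (p ^ v)))) n∣k*i))

  InO⇒valuation : ∀ {r} (i : Fin n) → r ≤ a → InO p (suc r) i → HasValuation (a ∸ r) (toℕ i)
  InO⇒valuation {r} i r≤a (p^r+1·i≡0 , minimal) = p^v∣i , p^v+1∤i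
    where
    v = a ∸ r
    r+1+v≡a+1 : suc r + v ≡ suc a
    r+1+v≡a+1 = cong suc (m+[n∸m]≡n r≤a)
    p^v∣i : p ^ v ∣ toℕ i
    p^v∣i = *-cancelˡ-∣ (p ^ suc r) {{m^n≢0 p (suc r)}} (subst (_∣ p ^ suc r * toℕ i) (n≡p^*p^ (suc r) v r+1+v≡a+1)
      (m%n≡0⇒n∣m _ n (trans (sym (toℕ-smul (p ^ suc r) i)) p^r+1·i≡0)))
    p^v+1∤i : ¬ p ^ suc v ∣ toℕ i
    p^v+1∤i d = minimal (p ^ r) (m^n>0 p r) (^-monoʳ-< p 1<p (n<1+n r))
      (trans (toℕ-smul (p ^ r) i) (n∣m⇒m%n≡0 _ n n∣p^r*i))
      where
      n∣p^r*i : n ∣ p ^ r * toℕ i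
      n∣p^r*i = subst (_∣ p ^ r * toℕ i) (sym (n≡p^*p^ r (suc v) (trans (+-suc r v) r+1+v≡a+1))) (*-monoʳ-∣ (p ^ r) d)

  InO-zero : InO p 0 zeroₙ
  InO-zero = trans (toℕ-smul 1 zeroₙ) (trans (cong (λ t → (1 * t) % n) toℕ-zeroₙ) (m<n⇒m%n≡m (>-nonZero⁻¹ n))) ,
    λ { k 0<k (s≤s k≤0) _ → <⇒≱ 0<k k≤0 }

  pow-in-orbit : ∀ {t} → t ≤ a → InO p (suc t) (pow (a ∸ t))
  pow-in-orbit {t} t≤a = subst (λ r → InO p (suc r) (pow (a ∸ t))) (m∸[m∸n]≡n t≤a)
    (valuation⇒InO (pow (a ∸ t)) (m∸n≤m a t) (pow-valuation (m∸n≤m a t)))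

  orbit-inhabited : ∀ r → r ≤ suc a → ∃ λ (i : Fin n) → InO p r i
  orbit-inhabited zero    _           = zeroₙ , InO-zero
  orbit-inhabited (suc t) (s≤s t≤a)   = pow (a ∸ t) , pow-in-orbit t≤a

  digit<n : ∀ {r c} → r ≤ a → c < p → c * p ^ r < n
  digit<n {r} r≤a c<p = ≤-trans (*-monoˡ-< (p ^ r) {{m^n≢0 p r}} c<p) (^-monoʳ-≤ p (s≤s r≤a))

module OrbitConstancy (p a : ℕ) (pr : Prime p) (A : Fin (p ^ suc a) → ℕ)
  (integral : ∀ z → ¬ toℕ z ≡ 0 → ∃ λ c → Eqζ p (suc a) (𝓕 A z) (const c)) where

  open PrimePowerResidues p a pr

  LocallyConstant : ℕ → Set
  LocallyConstant s = ∀ x y → ¬ p ^ s ∣ toℕ x → toℕ x %p^ s ≡ toℕ y %p^ s → A x ≡ A y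

  -- The fibre of i ↦ i p^j over x p^j is the class of x modulo p^(s+1), and translating the
  -- fibre by p^s moves its image by q ≠ 0; periodicity of the fibre sums then forces the
  -- (constant) values of A on the fibre and on its translate to agree.
  shift-invariant-core : ∀ j s → j + suc s ≡ suc a → LocallyConstant (suc s) → ∀ x →
    ¬ p ^ suc s ∣ toℕ x → ¬ p ^ suc s ∣ toℕ (shift (p ^ s) x) → A x ≡ A (shift (p ^ s) x)
  shift-invariant-core j s j+s+1≡a+1 lc x p^s+1∤x p^s+1∤x+p^s =
    fibre-values-agree A z k (p ^ s) periodic
      (λ i i∈ → sym (lc x i p^s+1∤x (sym (class i i∈))))
      (λ i i∈ → sym (lc (shift (p ^ s) x) (shift (p ^ s) i) p^s+1∤x+p^s
                        (shift-cong-%p^ (p ^ s) x i (s≤s s≤a) (sym (class i i∈)))))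
      x (pow-in-own-fibre x j≤a)
    where
    open ≡-Reasoning
    j≤a = m+[1+s]≡1+a⇒m≤a j s j+s+1≡a+1
    s≤a = m+[1+s]≡1+a⇒s≤a j s j+s+1≡a+1
    z = pow j
    k = el (toℕ x * p ^ j)
    class : ∀ i → InFibre z k i → toℕ i %p^ suc s ≡ toℕ x %p^ suc s
    class = fibre-of-pow-class j s j+s+1≡a+1 (toℕ x)
    q≡p^s*p^j : q ≡ p ^ s * p ^ j
    q≡p^s*p^j = trans (cong (p ^_) (sym (trans (+-comm s j) (m+[1+s]≡1+a⇒m+s≡a j s j+s+1≡a+1)))) (^-distribˡ-+-* p s j)
    k≢0 : ¬ toℕ k ≡ 0
    k≢0 ≡0 = p^s+1∤x (*p^%n≡0⇒p^∣ j (suc s) j+s+1≡a+1 (toℕ x) (trans (sym (toℕ-el _)) ≡0))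
    toℕ-k+q : toℕ (shift q k) ≡ ((toℕ x + p ^ s) * p ^ j) % n
    toℕ-k+q = begin
      toℕ (shift q k)                       ≡⟨ toℕ-el _ ⟩
      (toℕ k + q) % n                       ≡⟨ cong (λ t → (t + q) % n) (toℕ-el _) ⟩
      ((toℕ x * p ^ j) % n + q) % n         ≡⟨ [m%n+o]%n≡[m+o]%n _ q n ⟩
      (toℕ x * p ^ j + q) % n               ≡⟨ cong (λ t → (toℕ x * p ^ j + t) % n) q≡p^s*p^j ⟩
      (toℕ x * p ^ j + p ^ s * p ^ j) % n   ≡⟨ cong (_% n) (*-distribʳ-+ (p ^ j) (toℕ x) (p ^ s)) ⟨
      ((toℕ x + p ^ s) * p ^ j) % n         ∎
    k+q≢0 : ¬ toℕ (shift q k) ≡ 0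
    k+q≢0 ≡0 = p^s+1∤x+p^s (subst (p ^ suc s ∣_) (sym (toℕ-el _))
      (Equivalence.from (p^∣%n⇔p^∣ _ (s≤s s≤a))
        (*p^%n≡0⇒p^∣ j (suc s) j+s+1≡a+1 (toℕ x + p ^ s) (trans (sym toℕ-k+q) ≡0))))
    periodic : fibreSum A z k ≡ fibreSum A z (shift (toℕ z * p ^ s) k)
    periodic with integral z (pow≢0 j≤a)
    ... | c , 𝓕≈c = begin
      fibreSum A z k                          ≡⟨ fibreSum-periodic-off-0 A z c 𝓕≈c k k≢0 k+q≢0 ⟩
      fibreSum A z (shift q k)                ≡⟨ cong (λ t → fibreSum A z (shift t k)) q≡z*p^s ⟩
      fibreSum A z (shift (toℕ z * p ^ s) k)  ∎
      where
      q≡z*p^s : q ≡ toℕ z * p ^ s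
      q≡z*p^s = trans q≡p^s*p^j (trans (*-comm (p ^ s) (p ^ j)) (cong (_* p ^ s) (sym (toℕ-pow j≤a))))

  shift-invariant : ∀ j s → j + suc s ≡ suc a → LocallyConstant (suc s) →
    ∀ x → ¬ p ^ s ∣ toℕ x → A x ≡ A (shift (p ^ s) x)
  shift-invariant j s j+s+1≡a+1 lc x p^s∤x = shift-invariant-core j s j+s+1≡a+1 lc x
    (λ d → p^s∤x (∣-trans (p^-∣-mono (n≤1+n s)) d))
    (λ d → p^s∤x (∣m+n∣m⇒∣n (subst (p ^ s ∣_) (+-comm (toℕ x) (p ^ s)) (p^s∣x+p^s d)) ∣-refl))
    where
    p^s∣x+p^s : p ^ suc s ∣ toℕ (shift (p ^ s) x) → p ^ s ∣ toℕ x + p ^ s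
    p^s∣x+p^s d = ∣-trans (p^-∣-mono (n≤1+n s)) (Equivalence.to (p^∣%n⇔p^∣ _ (s≤s (m+[1+s]≡1+a⇒s≤a j s j+s+1≡a+1)))
      (subst (p ^ suc s ∣_) (toℕ-el _) d))

  same-class⇒translate : ∀ s → s ≤ suc a → ∀ (x y : Fin n) → toℕ x %p^ s ≡ toℕ y %p^ s →
    ∃ λ t → el (toℕ x + p ^ s * t) ≡ y
  same-class⇒translate s s≤a+1 x y x≡y = t , el≡ y (begin
    (toℕ x + d * t) % n     ≡⟨ cong (_% n) x+d*t≡y+n ⟩
    (toℕ y + n) % n         ≡⟨ [m+n]%n≡m%n (toℕ y) n ⟩
    toℕ y % n               ≡⟨ toℕ%N y ⟩
    toℕ y                   ∎)
    where
    open ≡-Reasoning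
    d = p ^ s
    instance
      d-nonZero : NonZero d
      d-nonZero = m^n≢0 p s
    u = toℕ x / d
    v = toℕ y / d
    w = n / d
    t = v + (w ∸ u)
    K = d * (w ∸ u)
    u≤w : u ≤ w
    u≤w = /-monoˡ-≤ d (<⇒≤ (FinP.toℕ<n x))
    K+d*u≡n : K + d * u ≡ n
    K+d*u≡n = begin
      d * (w ∸ u) + d * u     ≡⟨ cong (_+ d * u) (*-distribˡ-∸ d w u) ⟩
      (d * w ∸ d * u) + d * u ≡⟨ m∸n+n≡m (*-monoʳ-≤ d u≤w) ⟩
      d * w                   ≡⟨ m*[n/m]≡n (p^∣n s≤a+1) ⟩
      n                       ∎
    rearrange : ∀ r u d v K → (r + u * d) + (d * v + K) ≡ (r + v * d) + (K + d * u)
    rearrange = solve-∀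
    x+d*t≡y+n : toℕ x + d * t ≡ toℕ y + n
    x+d*t≡y+n = begin
      toℕ x + d * t                           ≡⟨ cong₂ _+_ (m≡m%n+[m/n]*n (toℕ x) d) (*-distribˡ-+ d v (w ∸ u)) ⟩
      (toℕ x %p^ s + u * d) + (d * v + K)     ≡⟨ rearrange (toℕ x %p^ s) u d v K ⟩
      (toℕ x %p^ s + v * d) + (K + d * u)     ≡⟨ cong₂ _+_ (cong (_+ v * d) x≡y) K+d*u≡n ⟩
      (toℕ y %p^ s + v * d) + n               ≡⟨ cong (_+ n) (m≡m%n+[m/n]*n (toℕ y) d) ⟨
      toℕ y + n                               ∎

  iterate-shift : ∀ s → s ≤ suc a → (∀ x → ¬ p ^ s ∣ toℕ x → A x ≡ A (shift (p ^ s) x)) →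
    ∀ t (x : Fin n) → ¬ p ^ s ∣ toℕ x → A (el (toℕ x + p ^ s * t)) ≡ A x
  iterate-shift s s≤a+1 inv zero x _ =
    cong A (trans (cong el (trans (cong (toℕ x +_) (*-zeroʳ (p ^ s))) (+-identityʳ (toℕ x)))) (el-toℕ x))
  iterate-shift s s≤a+1 inv (suc t) x p^s∤x = begin
    A (el (toℕ x + p ^ s * suc t))  ≡⟨ cong A (el≡ (shift (p ^ s) y) y+p^s) ⟩
    A (shift (p ^ s) y)             ≡⟨ inv y p^s∤y ⟨
    A y                             ≡⟨ iterate-shift s s≤a+1 inv t x p^s∤x ⟩
    A x                             ∎
    where
    open ≡-Reasoning
    y = el (toℕ x + p ^ s * t)
    p^s∤y : ¬ p ^ s ∣ toℕ y
    p^s∤y d = p^s∤x (∣m+n∣m⇒∣n (subst (p ^ s ∣_) (+-comm (toℕ x) _)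
      (Equivalence.to (p^∣%n⇔p^∣ _ s≤a+1) (subst (p ^ s ∣_) (toℕ-el _) d))) (m∣m*n t))
    y+p^s : (toℕ x + p ^ s * suc t) % n ≡ toℕ (shift (p ^ s) y)
    y+p^s = begin
      (toℕ x + p ^ s * suc t) % n         ≡⟨ cong (λ r → (toℕ x + r) % n) (trans (*-suc (p ^ s) t) (+-comm (p ^ s) _)) ⟩
      (toℕ x + (p ^ s * t + p ^ s)) % n   ≡⟨ cong (_% n) (+-assoc (toℕ x) _ (p ^ s)) ⟨
      (toℕ x + p ^ s * t + p ^ s) % n     ≡⟨ [m%n+o]%n≡[m+o]%n _ (p ^ s) n ⟨
      ((toℕ x + p ^ s * t) % n + p ^ s) % n ≡⟨ cong (λ r → (r + p ^ s) % n) (toℕ-el _) ⟨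
      (toℕ y + p ^ s) % n                 ≡⟨ toℕ-el _ ⟨
      toℕ (shift (p ^ s) y)               ∎

  locallyConstant-from-shift : ∀ s → s ≤ suc a → (∀ x → ¬ p ^ s ∣ toℕ x → A x ≡ A (shift (p ^ s) x)) →
    LocallyConstant s
  locallyConstant-from-shift s s≤a+1 inv x y p^s∤x x≡y with same-class⇒translate s s≤a+1 x y x≡y
  ... | t , x+p^s*t≡y = trans (sym (iterate-shift s s≤a+1 inv t x p^s∤x)) (cong A x+p^s*t≡y)

  locallyConstant-top : LocallyConstant (suc a)
  locallyConstant-top x y _ x≡y = cong A (FinP.toℕ-injective (trans (sym (toℕ%N x)) (trans x≡y (toℕ%N y))))

  locallyConstant : ∀ s → s ≤ suc a → LocallyConstant s
  locallyConstant s s≤a+1 = descend (suc a ∸ s) s (m∸n+n≡m s≤a+1)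
    where
    descend : ∀ j s → j + s ≡ suc a → LocallyConstant s
    descend zero    s s≡a+1     = subst LocallyConstant (sym s≡a+1) locallyConstant-top
    descend (suc j) s j+1+s≡a+1 = locallyConstant-from-shift s (subst (s ≤_) j+1+s≡a+1 (m≤n+m s (suc j)))
      (shift-invariant j s j+s+1≡a+1 (descend j (suc s) j+s+1≡a+1))
      where
      j+s+1≡a+1 : j + suc s ≡ suc a
      j+s+1≡a+1 = trans (+-suc j s) j+1+s≡a+1

  digit-step : ∀ r → r ≤ a → ∀ c → 1 ≤ c → suc c < p → A (el (c * p ^ r)) ≡ A (el (suc c * p ^ r))
  digit-step r r≤a c 1≤c c+1<p = trans
    (shift-invariant-core (a ∸ r) r a-r+r+1≡a+1 (locallyConstant (suc r) (s≤s r≤a)) x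
      (λ d → proj₂ (digit-valuation r 1≤c c<p) (subst (p ^ suc r ∣_) toℕ-x d))
      (λ d → proj₂ (digit-valuation r (s≤s z≤n) c+1<p) (subst (p ^ suc r ∣_) toℕ-x+p^r d)))
    (cong A x+p^r≡)
    where
    a-r+r+1≡a+1 : a ∸ r + suc r ≡ suc a
    a-r+r+1≡a+1 = trans (+-suc (a ∸ r) r) (cong suc (m∸n+n≡m r≤a))
    c<p : c < p
    c<p = <-trans (n<1+n c) c+1<p
    x = el (c * p ^ r)
    toℕ-x : toℕ x ≡ c * p ^ r
    toℕ-x = toℕ-el-< (digit<n r≤a c<p)
    x+p^r≡ : shift (p ^ r) x ≡ el (suc c * p ^ r)
    x+p^r≡ = cong el (trans (cong (_+ p ^ r) toℕ-x) (+-comm (c * p ^ r) (p ^ r)))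
    toℕ-x+p^r : toℕ (shift (p ^ r) x) ≡ suc c * p ^ r
    toℕ-x+p^r = trans (cong toℕ x+p^r≡) (toℕ-el-< (digit<n r≤a c+1<p))

  digit-constant : ∀ r → r ≤ a → ∀ c → 1 ≤ c → c < p → A (el (c * p ^ r)) ≡ A (pow r)
  digit-constant r r≤a (suc zero)    _ _     = cong (A ∘ el) (*-identityˡ (p ^ r))
  digit-constant r r≤a (suc (suc c)) _ c+2<p = trans (sym (digit-step r r≤a (suc c) (s≤s z≤n) c+2<p))
    (digit-constant r r≤a (suc c) (s≤s z≤n) (<-trans (n<1+n _) c+2<p))

  orbit-constant : ∀ r → r ≤ a → ∀ x → HasValuation r (toℕ x) → A x ≡ A (pow r)
  orbit-constant r r≤a x (p^r∣x , p^r+1∤x) =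
    trans (locallyConstant (suc r) (s≤s r≤a) x (el (c * p ^ r)) p^r+1∤x same-class) (digit-constant r r≤a c 1≤c c<p)
    where
    open ≡-Reasoning
    instance
      p^r-nonZero : NonZero (p ^ r)
      p^r-nonZero = m^n≢0 p r
    b = toℕ x / p ^ r
    c = b % p
    c<p : c < p
    c<p = m%n<n b p
    1≤c : 1 ≤ c
    1≤c with c ℕ.≟ 0
    ... | yes c≡0 = ⊥-elim (p^r+1∤x (subst (p ^ suc r ∣_) (m/n*n≡m p^r∣x) (*-monoˡ-∣ (p ^ r) (m%n≡0⇒n∣m b p c≡0))))
    ... | no c≢0  = n≢0⇒n>0 c≢0
    same-class : toℕ x %p^ suc r ≡ toℕ (el (c * p ^ r)) %p^ suc r
    same-class = begin
      toℕ x %p^ suc r                     ≡⟨ cong (_%p^ suc r) (m/n*n≡m p^r∣x) ⟨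
      (b * p ^ r) %p^ suc r               ≡⟨ m%n*o≡m*o%[n*o] b p (p ^ r) {{_}} {{m^n≢0 p (suc r)}} ⟨
      b % p * p ^ r                       ≡⟨ cong (_* p ^ r) (m%n%n≡m%n b p) ⟨
      c % p * p ^ r                       ≡⟨ m%n*o≡m*o%[n*o] c p (p ^ r) {{_}} {{m^n≢0 p (suc r)}} ⟩
      (c * p ^ r) %p^ suc r               ≡⟨ cong (_%p^ suc r) (toℕ-el-< (digit<n r≤a c<p)) ⟨
      toℕ (el (c * p ^ r)) %p^ suc r      ∎

  orbit-value : ∀ {t} → t ≤ a → ∀ i → InO p (suc t) i → A i ≡ A (pow (a ∸ t))
  orbit-value {t} t≤a i i∈O = orbit-constant (a ∸ t) (m∸n≤m a t) i (InO⇒valuation i t≤a i∈O)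

MultSum-both : ∀ {k} {P Q : Set} → P → Q → k ≡ 2 → MultSum k P Q
MultSum-both p q k≡2 =
  (λ _ _ → k≡2) , (λ _ ¬q → ⊥-elim (¬q q)) , (λ ¬p _ → ⊥-elim (¬p p)) , (λ ¬p _ → ⊥-elim (¬p p))

MultSum-right : ∀ {k} {P Q : Set} → ¬ P → Q → k ≡ 1 → MultSum k P Q
MultSum-right ¬p q k≡1 =
  (λ p _ → ⊥-elim (¬p p)) , (λ p _ → ⊥-elim (¬p p)) , (λ _ _ → k≡1) , (λ _ ¬q → ⊥-elim (¬q q))

MultSum-none : ∀ {k} {P Q : Set} → ¬ P → ¬ Q → k ≡ 0 → MultSum k P Q
MultSum-none ¬p ¬q k≡0 =
  (λ p _ → ⊥-elim (¬p p)) , (λ p _ → ⊥-elim (¬p p)) , (λ _ q → ⊥-elim (¬q q)) , (λ _ _ → k≡0)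

ind≤1 : ∀ b → ind b ≤ 1
ind≤1 true  = ≤-refl
ind≤1 false = z≤n

ind≡0⇒false : ∀ {b} → ind b ≡ 0 → b ≡ false
ind≡0⇒false {false} _ = refl

ΔU≤2 : ∀ {N} (X : Fin N → Bool) i → ΔU X i ≤ 2
ΔU≤2 X i = +-mono-≤ (ind≤1 (X i)) (ind≤1 (X (neg i)))

ΔU≡0⇒symmetric : ∀ {N} (X : Fin N → Bool) i → ΔU X i ≡ 0 → X i ≡ X (neg i)
ΔU≡0⇒symmetric X i ΔU≡0 =
  trans (ind≡0⇒false (m+n≡0⇒m≡0 _ ΔU≡0)) (sym (ind≡0⇒false (m+n≡0⇒n≡0 (ind (X i)) ΔU≡0)))

1≤k≤2⇒k≡1⊎k≡2 : ∀ {k} → 1 ≤ k → k ≤ 2 → k ≡ 1 ⊎ k ≡ 2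
1≤k≤2⇒k≡1⊎k≡2 {suc zero}          _ _ = inj₁ refl
1≤k≤2⇒k≡1⊎k≡2 {suc (suc zero)}    _ _ = inj₂ refl
1≤k≤2⇒k≡1⊎k≡2 {suc (suc (suc _))} _ (s≤s (s≤s ()))

module Classification (p a : ℕ) (pr : Prime p) (X : Fin (p ^ suc a) → Bool) (m : ℕ)
  (hyp : ∀ z → ¬ toℕ z ≡ 0 →
    Eqζ p (suc a) (𝓕 (ΔU X) z) (const (ℤ.+ 0)) ⊎ Eqζ p (suc a) (𝓕 (ΔU X) z) (const (- (ℤ.+ m))))
  (X0 : ∀ i → toℕ i ≡ 0 → X i ≡ false) (asym : ¬ (∀ i → X i ≡ X (neg i))) (1≤m : 1 ≤ m) where

  open PrimePowerResidues p a pr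

  U : Fin n → ℕ
  U = ΔU X

  integral : ∀ z → ¬ toℕ z ≡ 0 → ∃ λ c → Eqζ p (suc a) (𝓕 U z) (const c)
  integral z z≢0 with hyp z z≢0
  ... | inj₁ 𝓕≈0  = ℤ.+ 0 , 𝓕≈0
  ... | inj₂ 𝓕≈-m = - ℤ.+ m , 𝓕≈-m

  open OrbitConstancy p a pr U integral

  U-zero : ∀ i → toℕ i ≡ 0 → U i ≡ 0
  U-zero i i≡0 = cong₂ (λ b b′ → ind b + ind b′) (X0 i i≡0) (X0 (neg i) neg-i≡0)
    where
    neg-i≡0 : toℕ (neg i) ≡ 0
    neg-i≡0 = trans (toℕ-ofℕ i _) (trans (cong (λ t → (n ∸ t) % n) i≡0) (n%n≡0 n))

  Vanishes : ℕ → Set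
  Vanishes e = ∀ x → p ^ e ∣ toℕ x → U x ≡ 0

  vanishes-top : Vanishes (suc a)
  vanishes-top x p^a+1∣x = U-zero x (trans (sym (toℕ%N x)) (n∣m⇒m%n≡0 _ n p^a+1∣x))

  ¬vanishes-everywhere : ¬ Vanishes 0
  ¬vanishes-everywhere van = asym λ i → ΔU≡0⇒symmetric X i (van i (1∣ _))

  fibres-agree : ∀ z → Eqζ p (suc a) (𝓕 U z) (const (ℤ.+ 0)) → fibreSum U z zeroₙ ≡ fibreSum U z qₙ
  fibres-agree z 𝓕≈0 = ℤP.+-injective
    (trans (sym (ℤP.+-identityʳ _)) (fibreSum-jump-at-0 U z (ℤ.+ 0) 𝓕≈0 zeroₙ toℕ-zeroₙ qₙ≢0))

  fibres-jump : ∀ z → Eqζ p (suc a) (𝓕 U z) (const (- ℤ.+ m)) → fibreSum U z zeroₙ + m ≡ fibreSum U z qₙ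
  fibres-jump z 𝓕≈-m = ℤP.+-injective
    (trans (cong (ℤ._+_ (ℤ.+ fibreSum U z zeroₙ)) (sym (ℤP.neg-involutive (ℤ.+ m))))
      (fibreSum-jump-at-0 U z (- ℤ.+ m) 𝓕≈-m zeroₙ toℕ-zeroₙ qₙ≢0))

  -- For z = p^(a-r) the fibre of i ↦ i z over 0 is p^(r+1)ℤ_n, and the fibre over q is the set of
  -- elements of valuation r.
  fibre-0-vanishes : ∀ r → r ≤ a → Vanishes (suc r) → fibreSum U (pow (a ∸ r)) zeroₙ ≡ 0
  fibre-0-vanishes r r≤a van = fibreSum-const U 0 λ i i∈ →
    van i (fibre-of-pow-over-0 (a ∸ r) r (trans (+-suc (a ∸ r) r) (cong suc (m∸n+n≡m r≤a))) i i∈)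

  fibre-q-value : ∀ r → r ≤ a → fibreSum U (pow (a ∸ r)) qₙ ≡ U (pow r) * fibreSize (pow (a ∸ r)) qₙ
  fibre-q-value r r≤a = fibreSum-const U (U (pow r)) λ i i∈ → orbit-constant r r≤a i
    (subst (λ v → HasValuation v (toℕ i)) (m∸[m∸n]≡n r≤a)
      (fibre-over-q-valuation (pow (a ∸ r)) i (m∸n≤m a r) (pow-valuation (m∸n≤m a r)) i∈))

  fibre-q-nonZero : ∀ r → r ≤ a → NonZero (fibreSize (pow (a ∸ r)) qₙ)
  fibre-q-nonZero r r≤a = fibreSize-nonZero (pow r) (pow-in-fibre-over-q (a ∸ r) r (m∸n+n≡m r≤a))

  record Threshold : Set where
    field
      level      : ℕ
      level≤a    : level ≤ a
      vanishes   : Vanishes (suc level)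
      positive   : 1 ≤ U (pow level)
      in-Γ       : InΓ p (suc a) X m (pow (a ∸ level))

  level-step : ∀ r → r ≤ a → Vanishes (suc r) → Vanishes r ⊎ Threshold
  level-step r r≤a van with hyp (pow (a ∸ r)) (pow≢0 (m∸n≤m a r))
  ... | inj₁ 𝓕≈0  = inj₁ λ x p^r∣x → case p ^ suc r ∣? toℕ x of λ where
          (yes p^r+1∣x) → van x p^r+1∣x
          (no p^r+1∤x)  → trans (orbit-constant r r≤a x (p^r∣x , p^r+1∤x)) U-pow-r≡0
    where
    U-pow-r≡0 : U (pow r) ≡ 0
    U-pow-r≡0 = m*n≡0⇒m≡0 _ _ {{fibre-q-nonZero r r≤a}}
      (trans (sym (fibre-q-value r r≤a)) (trans (sym (fibres-agree _ 𝓕≈0)) (fibre-0-vanishes r r≤a van)))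
  ... | inj₂ 𝓕≈-m = inj₂ (record { level = r ; level≤a = r≤a ; vanishes = van ; positive = positive ; in-Γ = 𝓕≈-m })
    where
    positive : 1 ≤ U (pow r)
    positive with U (pow r) ℕ.≟ 0
    ... | no U≢0  = n≢0⇒n>0 U≢0
    ... | yes U≡0 = ⊥-elim (<⇒≢ 1≤m (sym (begin
      m                                        ≡⟨ cong (_+ m) (fibre-0-vanishes r r≤a van) ⟨
      fibreSum U (pow (a ∸ r)) zeroₙ + m       ≡⟨ fibres-jump _ 𝓕≈-m ⟩
      fibreSum U (pow (a ∸ r)) qₙ              ≡⟨ fibre-q-value r r≤a ⟩
      U (pow r) * fibreSize (pow (a ∸ r)) qₙ   ≡⟨ cong (_* fibreSize (pow (a ∸ r)) qₙ) U≡0 ⟩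
      0                                        ∎)))
      where open ≡-Reasoning

  threshold-below : ∀ r → r ≤ a → Vanishes (suc r) → Threshold
  threshold-below zero    r≤a van = [ ⊥-elim ∘ ¬vanishes-everywhere , id ] (level-step zero r≤a van)
  threshold-below (suc r) r≤a van =
    [ threshold-below r (≤-trans (n≤1+n r) r≤a) , id ] (level-step (suc r) r≤a van)

  module AboveThreshold (t : Threshold) where

    open Threshold t

    β : ℕ
    β = a ∸ level

    β≤a : β ≤ a
    β≤a = m∸n≤m a level

    positive-below : ∀ v → v ≤ level → 1 ≤ U (pow v)
    positive-below v v≤level with m≤n⇒m<n∨m≡n v≤level
    ... | inj₂ refl     = positive
    ... | inj₁ v<level with U (pow v) ℕ.≟ 0
    ...   | no U≢0  = n≢0⇒n>0 U≢0
    ...   | yes U≡0 = ⊥-elim (impossible (hyp z (pow≢0 (m∸n≤m a v))))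
      where
      v≤a : v ≤ a
      v≤a = ≤-trans v≤level level≤a
      z = pow (a ∸ v)
      a+1≤level+a-v : suc a ≤ level + (a ∸ v)
      a+1≤level+a-v = subst (_≤ level + (a ∸ v)) (cong suc (m+[n∸m]≡n v≤a)) (+-monoˡ-≤ (a ∸ v) v<level)
      fibre-0-positive : 1 ≤ fibreSum U z zeroₙ
      fibre-0-positive = ≤-trans positive
        (term≤fibreSum U (pow level) (pow-in-fibre-over-0 (m∸n≤m a v) level≤a a+1≤level+a-v))
      fibre-q≡0 : fibreSum U z qₙ ≡ 0
      fibre-q≡0 = trans (fibre-q-value v v≤a) (cong (_* fibreSize z qₙ) U≡0)
      impossible : Eqζ p (suc a) (𝓕 U z) (const (ℤ.+ 0)) ⊎ Eqζ p (suc a) (𝓕 U z) (const (- ℤ.+ m)) → ⊥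
      impossible (inj₁ 𝓕≈0)  = case subst (1 ≤_) (trans (fibres-agree z 𝓕≈0) fibre-q≡0) fibre-0-positive of λ ()
      impossible (inj₂ 𝓕≈-m) = <⇒≢ 1≤m (sym (m+n≡0⇒n≡0 _ (trans (fibres-jump z 𝓕≈-m) fibre-q≡0)))

    β-isMinVal : IsMinVal p (suc a) X m β
    β-isMinVal = (pow β , in-Γ , valuation⇒IsVal (pow β) β≤a (pow-valuation β≤a)) , minimal
      where
      minimal : ∀ z v → InΓ p (suc a) X m z → IsVal p (suc a) z v → β ≤ v
      minimal z v z∈Γ z-val with β ℕ.≤? v
      ... | yes β≤v = β≤v
      ... | no β≰v  = ⊥-elim (<⇒≢ 1≤m (sym (m+n≡0⇒n≡0 _ (trans (fibres-jump z z∈Γ) fibre-q≡0))))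
        where
        v<β : v < β
        v<β = ≰⇒> β≰v
        v≤a : v ≤ a
        v≤a = <⇒≤ (<-≤-trans v<β β≤a)
        level+1≤a-v : suc level ≤ a ∸ v
        level+1≤a-v = m+n≤o⇒m≤o∸n (suc level)
          (subst (_≤ a) (cong suc (+-comm v level)) (m≤o∸n⇒m+n≤o (suc v) level≤a v<β))
        fibre-q≡0 : fibreSum U z qₙ ≡ 0
        fibre-q≡0 = fibreSum-const U 0 λ i i∈ → vanishes i (∣-trans (p^-∣-mono level+1≤a-v)
          (proj₁ (fibre-over-q-valuation z i v≤a (IsVal⇒valuation z v≤a z-val) i∈)))

    nonzero-orbit⇒above-β : ∀ {k} r → r ≤ suc a → (∀ i → InO p r i → U i ≡ k) → ¬ k ≡ 0 → β < r
    nonzero-orbit⇒above-β zero    _         U≡k k≢0 =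
      ⊥-elim (k≢0 (trans (sym (U≡k zeroₙ InO-zero)) (U-zero zeroₙ toℕ-zeroₙ)))
    nonzero-orbit⇒above-β (suc t) (s≤s t≤a) U≡k k≢0 with a ∸ t ℕ.≤? level
    ... | yes a-t≤level = s≤s (m∸n≤o⇒m∸o≤n a t level a-t≤level)
    ... | no a-t≰level  = ⊥-elim (k≢0 (trans (sym (U≡k _ (pow-in-orbit t≤a))) (vanishes (pow (a ∸ t))
          (subst (p ^ suc level ∣_) (sym (toℕ-pow (m∸n≤m a t))) (p^-∣-mono (≰⇒> a-t≰level))))))

    I⇒above-β : ∀ r → I₁ p (suc a) X r ⊎ I₂ p (suc a) X r → β < r × r ≤ suc a
    I⇒above-β r (inj₁ (r≤a+1 , U≡2)) = nonzero-orbit⇒above-β r r≤a+1 U≡2 (λ ()) , r≤a+1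
    I⇒above-β r (inj₂ (r≤a+1 , U≡1)) = nonzero-orbit⇒above-β r r≤a+1 U≡1 (λ ()) , r≤a+1

    above-β⇒I : ∀ r → β < r × r ≤ suc a → I₁ p (suc a) X r ⊎ I₂ p (suc a) X r
    above-β⇒I (suc t) (s≤s β≤t , s≤s t≤a)
      with 1≤k≤2⇒k≡1⊎k≡2 (positive-below (a ∸ t) (m∸n≤o⇒m∸o≤n a level t β≤t)) (ΔU≤2 X (pow (a ∸ t)))
    ... | inj₁ U≡1 = inj₂ (s≤s t≤a , λ i i∈O → trans (orbit-value t≤a i i∈O) U≡1)
    ... | inj₂ U≡2 = inj₁ (s≤s t≤a , λ i i∈O → trans (orbit-value t≤a i i∈O) U≡2)

    I-disjoint : ∀ r → ¬ (I₁ p (suc a) X r × I₂ p (suc a) X r)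
    I-disjoint r ((r≤a+1 , U≡2) , (_ , U≡1)) with orbit-inhabited r r≤a+1
    ... | i , i∈O = case trans (sym (U≡2 i i∈O)) (U≡1 i i∈O) of λ ()

    partition : ∀ r → ((I₁ p (suc a) X r ⊎ I₂ p (suc a) X r) ⇔ (β < r × r ≤ suc a)) ×
                      ¬ (I₁ p (suc a) X r × I₂ p (suc a) X r)
    partition r = mk⇔ (I⇒above-β r) (above-β⇒I r) , I-disjoint r

    InMult-β⇔ : ∀ i → InMult p (suc a ∸ β) i ⇔ p ^ suc level ∣ toℕ i
    InMult-β⇔ i = subst (λ e → InMult p e i ⇔ p ^ suc level ∣ toℕ i) (sym a+1-β≡level+1)
      (InMult⇔p^∣ i (s≤s level≤a))
      where
      a+1-β≡level+1 : suc a ∸ β ≡ suc level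
      a+1-β≡level+1 = trans (+-∸-assoc 1 β≤a) (cong suc (m∸[m∸n]≡n level≤a))

    ≢2⇒outside-I₁ : ∀ i → ¬ U i ≡ 2 → ¬ (∃ λ r → I₁ p (suc a) X r × InO p r i)
    ≢2⇒outside-I₁ i U≢2 (_ , (_ , U≡2) , i∈O) = U≢2 (U≡2 i i∈O)

    multiplicity-below : ∀ {v} i → v ≤ level → HasValuation v (toℕ i) → ¬ InMult p (suc a ∸ β) i →
      MultSum (U i) (∃ λ r → I₁ p (suc a) X r × InO p r i) (¬ InMult p (suc a ∸ β) i)
    multiplicity-below {v} i v≤level i-val ¬inMult
      with 1≤k≤2⇒k≡1⊎k≡2 (positive-below v v≤level) (ΔU≤2 X (pow v))
    ... | inj₁ U≡1 = MultSum-right (≢2⇒outside-I₁ i λ U≡2 → case trans (sym U≡2) (trans U-i U≡1) of λ ())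
                       ¬inMult (trans U-i U≡1)
      where
      U-i = orbit-constant v (≤-trans v≤level level≤a) i i-val
    ... | inj₂ U≡2 = MultSum-both (suc (a ∸ v) , I₁-orbit , valuation⇒InO i v≤a i-val) ¬inMult (trans U-i U≡2)
      where
      v≤a = ≤-trans v≤level level≤a
      U-i = orbit-constant v v≤a i i-val
      I₁-orbit : I₁ p (suc a) X (suc (a ∸ v))
      I₁-orbit = s≤s (m∸n≤m a v) , λ j j∈O →
        trans (orbit-value (m∸n≤m a v) j j∈O) (trans (cong (U ∘ pow) (m∸[m∸n]≡n v≤a)) U≡2)

    multiplicities : ∀ i → MultSum (U i) (∃ λ r → I₁ p (suc a) X r × InO p r i) (¬ InMult p (suc a ∸ β) i)
    multiplicities i with p ^ suc level ∣? toℕ i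
    ... | yes p^l+1∣i = MultSum-none (≢2⇒outside-I₁ i λ U≡2 → case trans (sym U≡2) U≡0 of λ ())
                          (λ ¬inMult → ¬inMult (Equivalence.from (InMult-β⇔ i) p^l+1∣i)) U≡0
      where
      U≡0 = vanishes i p^l+1∣i
    ... | no p^l+1∤i with valuation-< (suc level) (toℕ i) p^l+1∤i
    ...   | v , s≤s v≤level , i-val = multiplicity-below i v≤level i-val (p^l+1∤i ∘ Equivalence.to (InMult-β⇔ i))

open import Data.Integer using (+_)

lemma3p2 : (p α : ℕ) → Prime p → 1 ≤ α →
    (X : Fin (p ^ α) → Bool) →
    (∀ i → toℕ i ≡ 0 → X i ≡ false) →
    ¬ (∀ i → X i ≡ X (neg i)) →
    (m : ℕ) → 1 ≤ m →
    (∀ z → ¬ toℕ z ≡ 0 →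
      Eqζ p α (𝓕 (ΔU X) z) (const (+ 0)) ⊎ Eqζ p α (𝓕 (ΔU X) z) (const (- (+ m)))) →
    ∃ λ β → IsMinVal p α X m β ×
      (∀ r → ((I₁ p α X r ⊎ I₂ p α X r) ⇔ (β < r × r ≤ α)) × ¬ (I₁ p α X r × I₂ p α X r)) ×
      (∀ i → MultSum (ΔU X i) (∃ λ r → I₁ p α X r × InO p r i) (¬ InMult p (α ∸ β) i))
lemma3p2 p zero    pr () X X0 asym m 1≤m hyp
lemma3p2 p (suc a) pr _  X X0 asym m 1≤m hyp = β , β-isMinVal , partition , multiplicities
  where
  open Classification p a pr X m hyp X0 asym 1≤m
  open AboveThreshold (threshold-below a ≤-refl vanishes-top)
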